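{- There exists a family $\mathcal B$ of cardinality $\mathfrak c$ of infinite countable graphs such that every $G\in\mathcal B$ has the property that every graph obtained from $G$ by modifying finitely many edges has exactly one infinite connected component and only finitely many (possibly zero) finite connected components, and such that for any two distinct $G_0,G_1\in\mathcal B$ the sequences $\mathrm{ds}(G_0)$ and $\mathrm{ds}(G_1)$ differ at infinitely many indices.
   Context: For a graph $G$, its sequence of degrees $\mathrm{ds}(G)\in(\omega\cup\{\infty\})^{\omega\cup\{\infty\}}$ assigns to each $n\in\omega\cup\{\infty\}$ the number of vertices of $G$ of degree $n$ (with $\infty$ standing for infinitely many). -}

module Defs where

open import Level using (0ℓ)
open import Data.Nat using (ℕ; _≤_; _<_)
open import Data.Fin using (Fin)
open import Data.Bool using (Bool)
open import Data.List using (List)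
open import Data.List.Relation.Unary.Any using (Any)
open import Data.Product using (Σ; ∃; ∃-syntax; _×_; _,_)
open import Data.Sum using (_⊎_)
open import Relation.Nullary using (¬_)
open import Relation.Binary.PropositionalEquality using (_≡_; _≢_)
open import Relation.Binary.Construct.Closure.ReflexiveTransitive using (Star)
open import Function.Definitions using (Injective)

record Graph : Set₁ where
  field
    Adj    : ℕ → ℕ → Set
    sym    : ∀ {u v} → Adj u v → Adj v u
    irrefl : ∀ {v} → ¬ Adj v v
open Graph public

data ℕ∞ : Set where
  fin : ℕ → ℕ∞
  ∞   : ℕ∞

InfiniteSet : (ℕ → Set) → Set
InfiniteSet P = ∀ k → ∃[ w ] (k ≤ w × P w)

FiniteSet : (ℕ → Set) → Set
FiniteSet P = ∃[ b ] (∀ w → P w → w < b)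

HasCard : (ℕ → Set) → ℕ∞ → Set
HasCard P (fin n) = Σ (Fin n → ℕ) λ f →
  Injective _≡_ _≡_ f × (∀ i → P (f i)) × (∀ w → P w → ∃[ i ] (f i ≡ w))
HasCard P ∞ = InfiniteSet P

HasDegree : Graph → ℕ → ℕ∞ → Set
HasDegree G v d = HasCard (Adj G v) d

-- ds(G)(d) = c : the number of vertices of degree d is c
ds≡ : Graph → ℕ∞ → ℕ∞ → Set
ds≡ G d c = HasCard (λ v → HasDegree G v d) c

DiffersAt : Graph → Graph → ℕ∞ → Set
DiffersAt G₀ G₁ d = ∃[ c₀ ] ∃[ c₁ ] (c₀ ≢ c₁ × ds≡ G₀ d c₀ × ds≡ G₁ d c₁)

-- the set of indices in ω ∪ {∞} where they differ is infinite
-- (equivalently: infinitely many finite indices)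
DifferInfinitelyOften : Graph → Graph → Set
DifferInfinitelyOften G₀ G₁ = InfiniteSet (λ n → DiffersAt G₀ G₁ (fin n))

FiniteModification : Graph → Graph → Set
FiniteModification G G' = ∃[ L ] (∀ u v →
  ¬ Any (λ (p : ℕ × ℕ) → p ≡ (u , v) ⊎ p ≡ (v , u)) L →
  (Adj G u v → Adj G' u v) × (Adj G' u v → Adj G u v))

Conn : Graph → ℕ → ℕ → Set
Conn G = Star (Adj G)

UniqueInfiniteComponent : Graph → Set
UniqueInfiniteComponent G = ∃[ r ] (InfiniteSet (Conn G r) ×
  (∀ v → InfiniteSet (Conn G v) → Conn G v r))

FinitelyManyFiniteComponents : Graph → Set
FinitelyManyFiniteComponents G = ∃[ L ] (∀ v → FiniteSet (Conn G v) →
  Any (Conn G v) L)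

Robust : Graph → Set₁
Robust G = ∀ G' → FiniteModification G G' →
  UniqueInfiniteComponent G' × FinitelyManyFiniteComponents G'

-- G α consists of a complete "core" together with, for each j, a "gadget" vertex joined
-- exactly to the first δ j core vertices, where δ j is the number written in binary as 1
-- followed by the first j bits of α. Core vertices have infinite degree, so at finite
-- indices ds(G α) counts the values of δ: each δ j occurs exactly once in ds(G α), and not
-- at all in ds(G β) once j exceeds a place where α and β differ. After finitely many edge
-- changes, every vertex beyond the changed region is still joined to core vertex 0 by
-- unchanged edges; so that component is the unique infinite one, and the finitely many
-- remaining vertices leave room for only finitely many finite components.
module Submission where

open import Defs hiding (sym)
open import Data.Nat using (ℕ; zero; suc; _+_; _*_; _≤_; _<_; _⊔_; z≤n; s≤s; z<s; s≤s⁻¹; _<?_)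
open import Data.Nat.Properties
open import Data.Bool using (Bool; true; false)
open import Data.Product using (Σ; ∃-syntax; _×_; _,_; proj₁; proj₂)
open import Data.Sum using (_⊎_; inj₁; inj₂)
open import Data.Empty using (⊥; ⊥-elim)
open import Data.Fin using (Fin; toℕ; fromℕ<) renaming (zero to fzero; suc to fsuc)
open import Data.Fin.Properties using (toℕ-injective; toℕ<n; toℕ-fromℕ<; injective⇒≤)
open import Data.List using (List; []; _∷_; upTo)
open import Data.List.Relation.Unary.Any using (Any; here; there)
import Data.List.Relation.Unary.Any as Any
open import Data.List.Membership.Propositional.Properties using (∈-upTo⁺)
open import Relation.Nullary using (¬_; yes; no)
open import Relation.Binary.PropositionalEquality
  using (_≡_; _≢_; refl; sym; trans; cong; cong₂; subst)
open import Relation.Binary.Construct.Closure.ReflexiveTransitive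
  using (ε; _◅_; _◅◅_; reverse)
open import Function using (_∘_; id)
open import Function.Definitions using (Injective)

Fin-bounded : ∀ {n} (f : Fin n → ℕ) → ∃[ b ] (∀ i → f i < b)
Fin-bounded {zero}  f = 0 , λ ()
Fin-bounded {suc n} f =
  let (b , f<b) = Fin-bounded (f ∘ fsuc)
  in  suc (f fzero) + b , λ where
        fzero    → s≤s (m≤m+n (f fzero) b)
        (fsuc i) → <-≤-trans (f<b i) (m≤n+m b (suc (f fzero)))

module _ {P : ℕ → Set} where

  HasCard-fin-≤ : ∀ {m n} → HasCard P (fin m) → HasCard P (fin n) → m ≤ n
  HasCard-fin-≤ {m} {n} (f , f-inj , f∈P , _) (g , _ , _ , g-onto) = injective⇒≤ g⁻¹∘f-injective
    where
    g⁻¹∘f : Fin m → Fin n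
    g⁻¹∘f i = proj₁ (g-onto (f i) (f∈P i))

    g∘g⁻¹∘f : ∀ i → g (g⁻¹∘f i) ≡ f i
    g∘g⁻¹∘f i = proj₂ (g-onto (f i) (f∈P i))

    g⁻¹∘f-injective : Injective _≡_ _≡_ g⁻¹∘f
    g⁻¹∘f-injective {i} {i′} eq =
      f-inj (trans (sym (g∘g⁻¹∘f i)) (trans (cong g eq) (g∘g⁻¹∘f i′)))

  HasCard-fin-unique : ∀ {m n} → HasCard P (fin m) → HasCard P (fin n) → m ≡ n
  HasCard-fin-unique p q = ≤-antisym (HasCard-fin-≤ p q) (HasCard-fin-≤ q p)

  HasCard-fin⇒FiniteSet : ∀ {n} → HasCard P (fin n) → FiniteSet P
  HasCard-fin⇒FiniteSet (f , _ , _ , f-onto) =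
    let (b , f<b) = Fin-bounded f
    in  b , λ w w∈P → let (i , fi≡w) = f-onto w w∈P in subst (_< b) fi≡w (f<b i)

  InfiniteSet⇒¬FiniteSet : InfiniteSet P → ¬ FiniteSet P
  InfiniteSet⇒¬FiniteSet infinite (b , bounded) =
    let (w , b≤w , w∈P) = infinite b in <⇒≱ (bounded w w∈P) b≤w

  HasCard-empty : (∀ w → ¬ P w) → HasCard P (fin 0)
  HasCard-empty empty = (λ ()) , (λ { {()} }) , (λ ()) , λ w w∈P → ⊥-elim (empty w w∈P)

  HasCard-singleton : ∀ {x} → P x → (∀ w → P w → w ≡ x) → HasCard P (fin 1)
  HasCard-singleton {x} x∈P unique =
    (λ _ → x) , (λ { {fzero} {fzero} _ → refl }) , (λ _ → x∈P) , λ w w∈P → fzero , sym (unique w w∈P)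

ConnectedBeyond : Graph → ℕ → ℕ → Set
ConnectedBeyond G M r = ∀ v → M ≤ v → Conn G v r

module _ (G : Graph) {M r : ℕ} (connected : ConnectedBeyond G M r) where

  connectedBeyond⇒uniqueInfiniteComponent : UniqueInfiniteComponent G
  connectedBeyond⇒uniqueInfiniteComponent = r , r-infinite , λ v v-infinite →
    let (w , M≤w , v⇝w) = v-infinite M in v⇝w ◅◅ connected w M≤w
    where
    r-infinite : InfiniteSet (Conn G r)
    r-infinite k = k + M , m≤m+n k M , reverse (Graph.sym G) (connected (k + M) (m≤n+m M k))

  connectedBeyond⇒finitelyManyFiniteComponents : FinitelyManyFiniteComponents G
  connectedBeyond⇒finitelyManyFiniteComponents = r ∷ upTo M , λ v _ → represented v
    where
    represented : ∀ v → Any (Conn G v) (r ∷ upTo M)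
    represented v with v <? M
    ... | yes v<M = there (Any.map (λ { refl → ε }) (∈-upTo⁺ v<M))
    ... | no v≮M = here (connected v (≮⇒≥ v≮M))

KeepsEdgesBeyond : ℕ → Graph → Graph → Set
KeepsEdgesBeyond M G G′ = ∀ u v → M ≤ v → Adj G u v → Adj G′ u v

Listed : ℕ → ℕ → List (ℕ × ℕ) → Set
Listed u v = Any (λ p → p ≡ (u , v) ⊎ p ≡ (v , u))

pairBound : List (ℕ × ℕ) → ℕ
pairBound []            = 0
pairBound ((a , b) ∷ L) = suc (a + b) ⊔ pairBound L

listed⇒<pairBound : ∀ {u v} L → Listed u v L → v < pairBound L
listed⇒<pairBound {u} {v} (_ ∷ L) (here (inj₁ refl)) =
  <-≤-trans (s≤s (m≤n+m v u)) (m≤m⊔n (suc (u + v)) (pairBound L))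
listed⇒<pairBound {u} {v} (_ ∷ L) (here (inj₂ refl)) =
  <-≤-trans (s≤s (m≤m+n v u)) (m≤m⊔n (suc (v + u)) (pairBound L))
listed⇒<pairBound ((a , b) ∷ L) (there listed) =
  <-≤-trans (listed⇒<pairBound L listed) (m≤n⊔m (suc (a + b)) (pairBound L))

finiteModification⇒keepsEdgesBeyond : ∀ {G G′} → FiniteModification G G′ →
  ∃[ M ] KeepsEdgesBeyond M G G′
finiteModification⇒keepsEdgesBeyond (L , agree) = pairBound L , λ u v M≤v →
  proj₁ (agree u v (λ listed → <⇒≱ (listed⇒<pairBound L listed) M≤v))

data Node : Set where
  core gadget : ℕ → Node

index : Node → ℕ
index (core a)   = 2 * a
index (gadget j) = suc (2 * j)

next : Node → Node
next (core a)   = core (suc a)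
next (gadget j) = gadget (suc j)

node : ℕ → Node
node zero          = core 0
node (suc zero)    = gadget 0
node (suc (suc n)) = next (node n)

node-index : ∀ x → node (index x) ≡ x
node-index (core zero)      = refl
node-index (gadget zero)    = refl
node-index (core (suc a))   =
  trans (cong node (*-suc 2 a)) (cong next (node-index (core a)))
node-index (gadget (suc j)) =
  trans (cong (node ∘ suc) (*-suc 2 j)) (cong next (node-index (gadget j)))

index-node : ∀ v → index (node v) ≡ v
index-node zero          = refl
index-node (suc zero)    = refl
index-node (suc (suc n)) with node n | index-node n
... | core a   | refl = *-suc 2 a
... | gadget j | refl = cong suc (*-suc 2 j)

index-elim : (P : ℕ → Set) → (∀ x → P (index x)) → ∀ v → P v
index-elim P p v = subst P (index-node v) (p (node v))

coreBeyond : ℕ → ℕ → ℕ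
coreBeyond a n = suc (a + n)

≤index-coreBeyond : ∀ a n → n ≤ index (core (coreBeyond a n))
≤index-coreBeyond a n = ≤-trans (m≤n+m n (suc a)) (m≤n*m (coreBeyond a n) 2)

module _ (δ : ℕ → ℕ) where

  Link : Node → Node → Set
  Link (core a)   (core b)   = a ≢ b
  Link (core a)   (gadget j) = a < δ j
  Link (gadget j) (core a)   = a < δ j
  Link (gadget _) (gadget _) = ⊥

  Link-sym : ∀ x y → Link x y → Link y x
  Link-sym (core a)   (core b)   a≢b = a≢b ∘ sym
  Link-sym (core a)   (gadget j) a<δj = a<δj
  Link-sym (gadget j) (core a)   a<δj = a<δj

  Link-irrefl : ∀ x → ¬ Link x x
  Link-irrefl (core a) a≢a = a≢a refl

  gadgetGraph : Graph
  gadgetGraph = record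
    { Adj    = λ u v → Link (node u) (node v)
    ; sym    = λ {u} {v} → Link-sym (node u) (node v)
    ; irrefl = λ {v} → Link-irrefl (node v)
    }

  Adj-index : ∀ x y → Adj gadgetGraph (index x) (index y) ≡ Link x y
  Adj-index x y = cong₂ Link (node-index x) (node-index y)

  link⇒adj : ∀ x y → Link x y → Adj gadgetGraph (index x) (index y)
  link⇒adj x y = subst id (sym (Adj-index x y))

  adj⇒link : ∀ x y → Adj gadgetGraph (index x) (index y) → Link x y
  adj⇒link x y = subst id (Adj-index x y)

  core-infiniteDegree : ∀ a → InfiniteSet (Adj gadgetGraph (index (core a)))
  core-infiniteDegree a k =
    index (core b) , ≤index-coreBeyond a k , link⇒adj (core a) (core b) (m≢1+m+n a)
    where b = coreBeyond a k

  gadget-degree : ∀ j → HasDegree gadgetGraph (index (gadget j)) (fin (δ j))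
  gadget-degree j =
    neighbour , neighbour-injective ,
    (λ i → link⇒adj (gadget j) (core (toℕ i)) (toℕ<n i)) , index-elim Onto onto
    where
    neighbour : Fin (δ j) → ℕ
    neighbour i = index (core (toℕ i))

    neighbour-injective : Injective _≡_ _≡_ neighbour
    neighbour-injective eq = toℕ-injective (*-cancelˡ-≡ _ _ 2 eq)

    Onto : ℕ → Set
    Onto w = Adj gadgetGraph (index (gadget j)) w → ∃[ i ] (neighbour i ≡ w)

    onto : ∀ x → Onto (index x)
    onto (core a)    adj = fromℕ< a<δj , cong (index ∘ core) (toℕ-fromℕ< a<δj)
      where a<δj = adj⇒link (gadget j) (core a) adj
    onto (gadget j′) adj = ⊥-elim (adj⇒link (gadget j) (gadget j′) adj)

  finiteDegree⇒gadget : ∀ v {d} → HasDegree gadgetGraph v (fin d) →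
    ∃[ j ] (v ≡ index (gadget j) × δ j ≡ d)
  finiteDegree⇒gadget v {d} = index-elim Classify classify v
    where
    Classify : ℕ → Set
    Classify v = HasDegree gadgetGraph v (fin d) → ∃[ j ] (v ≡ index (gadget j) × δ j ≡ d)

    classify : ∀ x → Classify (index x)
    classify (core a)   deg = ⊥-elim
      (InfiniteSet⇒¬FiniteSet (core-infiniteDegree a) (HasCard-fin⇒FiniteSet deg))
    classify (gadget j) deg = j , refl , HasCard-fin-unique (gadget-degree j) deg

  ds≡-unique : ∀ i → (∀ j → δ j ≡ δ i → j ≡ i) → ds≡ gadgetGraph (fin (δ i)) (fin 1)
  ds≡-unique i δ-unique = HasCard-singleton (gadget-degree i) λ w deg →
    let (j , w≡j , δj≡δi) = finiteDegree⇒gadget w deg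
    in trans w≡j (cong (index ∘ gadget) (δ-unique j δj≡δi))

  ds≡-absent : ∀ d → (∀ j → δ j ≢ d) → ds≡ gadgetGraph (fin d) (fin 0)
  ds≡-absent d δ≢d = HasCard-empty λ w deg →
    let (j , _ , δj≡d) = finiteDegree⇒gadget w deg in δ≢d j δj≡d

  module _ (δ-positive : ∀ j → 0 < δ j) where

    gadgetGraph-connectedBeyond : ∀ {M G′} → KeepsEdgesBeyond M gadgetGraph G′ →
      ConnectedBeyond G′ M 0
    gadgetGraph-connectedBeyond {M} {G′} keep =
      index-elim (λ v → M ≤ v → Conn G′ v 0) toCore0
      where
      toCore0 : ∀ x → M ≤ index x → Conn G′ (index x) 0
      toCore0 (gadget j) M≤v =
        Graph.sym G′ (keep 0 _ M≤v (link⇒adj (core 0) (gadget j) (δ-positive j))) ◅ ε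
      toCore0 (core a)   _   =
        keep _ _ M≤far (link⇒adj (core a) (core b) (m≢1+m+n a)) ◅
        Graph.sym G′ (keep 0 _ M≤far (link⇒adj (core 0) (core b) λ ())) ◅ ε
        where
        b = coreBeyond a M
        M≤far = ≤index-coreBeyond a M

    gadgetGraph-robust : Robust gadgetGraph
    gadgetGraph-robust G′ modification =
      let (M , keep) = finiteModification⇒keepsEdgesBeyond {gadgetGraph} {G′} modification
          connected  = gadgetGraph-connectedBeyond {M} {G′} keep
      in  connectedBeyond⇒uniqueInfiniteComponent G′ connected ,
          connectedBeyond⇒finitelyManyFiniteComponents G′ connected

pushBit : Bool → ℕ → ℕ
pushBit false n = 2 * n
pushBit true  n = suc (2 * n)

pushBit-injective : ∀ b c {m n} → pushBit b m ≡ pushBit c n → b ≡ c × m ≡ n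
pushBit-injective false false {m} {n} eq = refl , *-cancelˡ-≡ m n 2 eq
pushBit-injective true  true  {m} {n} eq = refl , *-cancelˡ-≡ m n 2 (suc-injective eq)
pushBit-injective false true  {m} {n} eq = ⊥-elim (even≢odd m n eq)
pushBit-injective true  false {m} {n} eq = ⊥-elim (even≢odd n m (sym eq))

2*n≤pushBit : ∀ b n → 2 * n ≤ pushBit b n
2*n≤pushBit false n = ≤-refl
2*n≤pushBit true  n = n≤1+n (2 * n)

prefixCode : (ℕ → Bool) → ℕ → ℕ
prefixCode α zero    = 1
prefixCode α (suc m) = pushBit (α m) (prefixCode α m)

m<prefixCode : ∀ α m → m < prefixCode α m
m<prefixCode α zero    = z<s
m<prefixCode α (suc m) = begin-strict
  suc m             <⟨ m<m+n (suc m) z<s ⟩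
  suc m + suc m     ≤⟨ +-mono-≤ ih ih ⟩
  c + c             ≡⟨ cong (c +_) (sym (+-identityʳ c)) ⟩
  2 * c             ≤⟨ 2*n≤pushBit (α m) c ⟩
  pushBit (α m) c   ∎
  where
  open ≤-Reasoning
  c = prefixCode α m
  ih = m<prefixCode α m

1<prefixCode-suc : ∀ α m → 1 < prefixCode α (suc m)
1<prefixCode-suc α m = ≤-<-trans (s≤s z≤n) (m<prefixCode α (suc m))

prefixCode-injective : ∀ α β m n → prefixCode α m ≡ prefixCode β n →
  m ≡ n × (∀ i → i < m → α i ≡ β i)
prefixCode-injective α β zero    zero    _  = refl , λ _ ()
prefixCode-injective α β zero    (suc n) eq = ⊥-elim (<-irrefl eq (1<prefixCode-suc β n))
prefixCode-injective α β (suc m) zero    eq = ⊥-elim (<-irrefl (sym eq) (1<prefixCode-suc α m))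
prefixCode-injective α β (suc m) (suc n) eq
  with pushBit-injective (α m) (β n) eq
... | αm≡βn , codes≡ with prefixCode-injective α β m n codes≡
... | refl , agree = refl , agree′
  where
  agree′ : ∀ i → i < suc m → α i ≡ β i
  agree′ i i<1+m with m≤n⇒m<n∨m≡n (s≤s⁻¹ i<1+m)
  ... | inj₁ i<m  = agree i i<m
  ... | inj₂ refl = αm≡βn

prefixCode-separates : ∀ α β {n m} → α n ≢ β n → n < m → ∀ m′ → prefixCode α m ≢ prefixCode β m′
prefixCode-separates α β {n} {m} αn≢βn n<m m′ eq with prefixCode-injective α β m m′ eq
... | refl , agree = αn≢βn (agree n n<m)

proposition3p31 : Σ ((ℕ → Bool) → Graph) λ B →
    ((α : ℕ → Bool) → Robust (B α)) ×
    (∀ (α β : ℕ → Bool) → ∃[ n ] (α n ≢ β n) →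
      DifferInfinitelyOften (B α) (B β))
proposition3p31 = gadgetGraph ∘ prefixCode , robust , differ
  where
  robust : ∀ α → Robust (gadgetGraph (prefixCode α))
  robust α = gadgetGraph-robust (prefixCode α) λ m → ≤-<-trans z≤n (m<prefixCode α m)

  differ : ∀ α β → ∃[ n ] (α n ≢ β n) →
    DifferInfinitelyOften (gadgetGraph (prefixCode α)) (gadgetGraph (prefixCode β))
  differ α β (n , αn≢βn) k =
    prefixCode α m , <⇒≤ (<-trans k<m (m<prefixCode α m)) , fin 1 , fin 0 , (λ ()) ,
    ds≡-unique (prefixCode α) m (λ j eq → proj₁ (prefixCode-injective α α j m eq)) ,
    ds≡-absent (prefixCode β) (prefixCode α m)
      (λ j → prefixCode-separates α β αn≢βn n<m j ∘ sym)
    where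
    m = suc (n + k)
    k<m = s≤s (m≤n+m k n)
    n<m = s≤s (m≤m+n n k)
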